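{- Let $G=(V,E)$ be a graph with $V\ne\emptyset$ having neither isolated vertices nor isolated edges, and let $A\subseteq V$ be any set of vertices each of which is adjacent to a vertex of degree $1$. Then \[D_G(x)=\sum_{J\subseteq V\setminus A}(-1)^{|J|}(x+1)^{|V|-|N_G[J]|}=\sum_{\substack{J\subseteq V\setminus A\\|J|\le|V|-\delta(G)}}(-1)^{|J|}\Big[(x+1)^{|V|-|N_G[J]|}-1\Big].\]
   Context: All graphs are finite, undirected and simple. An isolated edge is an edge both of whose endpoints have degree 1. $D_G(x)=\sum_{k}d_k(G)x^k$ where $d_k(G)$ is the number of dominating sets of $G$ of size $k$ (a set $S$ is dominating if every vertex outside $S$ is adjacent to a vertex of $S$). $N_G[J]$ is the closed neighbourhood of $J$ (vertices in $J$ or adjacent to a vertex of $J$). $\delta(G)$ is the minimum degree of $G$. -}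

module Defs where

open import Data.Nat using (ℕ; zero; suc; _∸_; _≤_; _⊓_; _≡ᵇ_; _≤ᵇ_)
open import Data.Integer using (ℤ; +_; _+_; _-_; _*_; _^_; -1ℤ; 1ℤ; 0ℤ)
open import Data.Bool using (Bool; true; false; _∧_; _∨_; not)
open import Data.Fin using (Fin)
open import Data.Fin.Subset using (Subset; ∣_∣; inside; outside)
open import Data.Vec using (Vec; []; _∷_; lookup; tabulate)
open import Data.List using (List; []; _∷_; [_]; map; _++_; length; filterᵇ; foldr; upTo; allFin)
open import Relation.Binary.PropositionalEquality using (_≡_)

record Graph (n : ℕ) : Set where
  field
    adj    : Fin n → Fin n → Bool
    sym    : ∀ u v → adj u v ≡ adj v u
    irrefl : ∀ v → adj v v ≡ false
open Graph public

anyV : ∀ {n} → (Fin n → Bool) → Bool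
anyV {n} p = foldr (λ v b → p v ∨ b) false (allFin n)

allV : ∀ {n} → (Fin n → Bool) → Bool
allV {n} p = foldr (λ v b → p v ∧ b) true (allFin n)

allSubsets : ∀ n → List (Subset n)
allSubsets zero = [ [] ]
allSubsets (suc n) = map (inside ∷_) (allSubsets n) ++ map (outside ∷_) (allSubsets n)

deg : ∀ {n} → Graph n → Fin n → ℕ
deg G v = ∣ tabulate (adj G v) ∣

minDeg : ∀ {m} → Graph (suc m) → ℕ
minDeg {m} G = foldr (λ v k → deg G v ⊓ k) (deg G Fin.zero) (allFin (suc m))

closedNbhd : ∀ {n} → Graph n → Subset n → Subset n
closedNbhd G J = tabulate (λ v → lookup J v ∨ anyV (λ u → lookup J u ∧ adj G u v))

isDominating : ∀ {n} → Graph n → Subset n → Bool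
isDominating G S = allV (λ v → lookup S v ∨ anyV (λ u → lookup S u ∧ adj G u v))

domCount : ∀ {n} → Graph n → ℕ → ℕ
domCount {n} G k = length (filterᵇ (λ S → isDominating G S ∧ (∣ S ∣ ≡ᵇ k)) (allSubsets n))

sumℤ : List ℤ → ℤ
sumℤ = foldr _+_ 0ℤ

domPoly : ∀ {n} → Graph n → ℤ → ℤ
domPoly {n} G x = sumℤ (map (λ k → (+ domCount G k) * (x ^ k)) (upTo (suc n)))

avoids : ∀ {n} → Subset n → Subset n → Bool
avoids J A = allV (λ v → not (lookup J v ∧ lookup A v))

firstSum : ∀ {n} → Graph n → Subset n → ℤ → ℤ
firstSum {n} G A x =
  sumℤ (map (λ J → (-1ℤ ^ ∣ J ∣) * ((x + 1ℤ) ^ (n ∸ ∣ closedNbhd G J ∣)))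
            (filterᵇ (λ J → avoids J A) (allSubsets n)))

secondSum : ∀ {m} → Graph (suc m) → Subset (suc m) → ℤ → ℤ
secondSum {m} G A x =
  sumℤ (map (λ J → (-1ℤ ^ ∣ J ∣) * (((x + 1ℤ) ^ (suc m ∸ ∣ closedNbhd G J ∣)) - 1ℤ))
            (filterᵇ (λ J → avoids J A ∧ (∣ J ∣ ≤ᵇ (suc m ∸ minDeg G))) (allSubsets (suc m))))

-- [S dominating] = [N[S] = V] = Σ_{J ⊆ V ∖ N[S]} (-1)^|J|, and J ∩ N[S] = ∅ iff S ∩ N[J] = ∅;
-- summing x^|S| over all S and exchanging the sums gives D_G(x) = Σ_J (-1)^|J| (x+1)^(|V|-|N[J]|).
-- If a ∈ A has a pendant neighbour u ∉ A, toggling u in a set J ∋ a changes neither N[J] nor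
-- J ∩ A but flips the sign, so the terms with a ∈ J cancel.  For the second identity, a set J
-- with |J| > |V| - δ(G) meets the neighbourhood of every vertex, so N[J] = V and its term is
-- (-1)^|J|; the dropped terms therefore add up to Σ_{J ⊆ V ∖ A} (-1)^|J|, which vanishes since a
-- pendant vertex is never in A (there is no isolated edge) and so V ∖ A ≠ ∅.
module Submission where

open import Defs hiding (sym)
open import Data.Nat using (ℕ; suc; _≥_)
open import Data.Integer using (ℤ)
open import Data.Bool using (true)
open import Data.Fin using (Fin)
open import Data.Fin.Subset using (Subset; _∈_)
open import Data.Product using (_×_; ∃)
open import Relation.Binary.PropositionalEquality using (_≡_)
open import Relation.Nullary using (¬_)

open import Function using (_∘_; id; case_of_)
open import Data.Nat using (zero; _∸_; _≤_; _<_; _⊓_; _≡ᵇ_; _≤ᵇ_; z≤n; s≤s)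
import Data.Nat.Properties as ℕ
open import Data.Integer using (+_; _+_; _*_; _-_; -_; _^_; -1ℤ; 0ℤ; 1ℤ; -[1+_])
import Data.Integer.Properties as ℤ
open import Data.Integer.Tactic.RingSolver using (solve-∀)
open import Data.Bool using (Bool; false; if_then_else_; not; _∧_; _∨_; T)
import Data.Bool.Properties as Bool
open import Data.Fin using (zero; suc; _≟_)
open import Data.Fin.Subset using (∣_∣; inside; outside; ∁)
open import Data.Fin.Subset.Properties
  using (∣p∣≤n; x∈p⇒∣p-x∣<∣p∣; x∈p∧x≢y⇒x∈p-y; x∉p⇒x∈∁p; p⊆q⇒∣p∣≤∣q∣; ∣∁p∣≡n∸∣p∣)
open import Data.Vec using ([]; _∷_; lookup; tabulate; updateAt)
import Data.Vec.Properties as Vec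
open import Data.Vec.Relation.Binary.Pointwise.Extensional using (ext; Pointwise-≡⇒≡)
open import Data.List using (List; []; _∷_; map; _++_; length; filterᵇ; foldr; applyUpTo; upTo; allFin)
import Data.List.Properties as List
open import Data.List.Relation.Unary.Any using (Any; here; there)
open import Data.List.Membership.Propositional.Properties using (∈-allFin)
open import Data.Product using (_,_; proj₁; proj₂)
open import Data.Sum using (_⊎_; inj₁; inj₂)
open import Data.Empty using (⊥; ⊥-elim)
open import Relation.Nullary using (yes; no)
open import Relation.Binary.PropositionalEquality
  using (refl; sym; trans; cong; cong₂; subst; _≢_; module ≡-Reasoning)

private
  variable
    A B : Set
    n : ℕ

infixr 7.5 [_]×_

[_]×_ : Bool → ℤ → ℤ
[ b ]× y = if b then y else 0ℤ

[]×-*ˡ : ∀ b x y → [ b ]× (x * y) ≡ x * [ b ]× y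
[]×-*ˡ true  x y = refl
[]×-*ˡ false x y = sym (ℤ.*-zeroʳ x)

[]×-*ʳ : ∀ b x y → [ b ]× (x * y) ≡ [ b ]× x * y
[]×-*ʳ true  x y = refl
[]×-*ʳ false x y = refl

[]×-1 : ∀ b y → [ b ]× y ≡ [ b ]× 1ℤ * y
[]×-1 true  y = sym (ℤ.*-identityˡ y)
[]×-1 false y = refl

[]×-not∧-split : ∀ a r y → [ not (a ∧ true) ∧ r ]× y ≡ [ r ]× y - [ a ∧ r ]× y
[]×-not∧-split true  true  y = sym (ℤ.+-inverseʳ y)
[]×-not∧-split true  false y = refl
[]×-not∧-split false true  y = sym (ℤ.+-identityʳ y)
[]×-not∧-split false false y = refl

x≡-x⇒x≡0 : ∀ {x} → x ≡ - x → x ≡ 0ℤ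
x≡-x⇒x≡0 {+ zero}    _  = refl
x≡-x⇒x≡0 {+ suc _}   ()
x≡-x⇒x≡0 { -[1+ _ ]} ()

sumOver : List A → (A → ℤ) → ℤ
sumOver xs f = sumℤ (map f xs)

sumOver-++ : ∀ xs ys (f : A → ℤ) → sumOver (xs ++ ys) f ≡ sumOver xs f + sumOver ys f
sumOver-++ []       ys f = sym (ℤ.+-identityˡ _)
sumOver-++ (x ∷ xs) ys f =
  trans (cong (_+_ (f x)) (sumOver-++ xs ys f)) (sym (ℤ.+-assoc (f x) _ _))

sumOver-map : ∀ xs (g : A → B) (f : B → ℤ) → sumOver (map g xs) f ≡ sumOver xs (f ∘ g)
sumOver-map xs g f = cong sumℤ (sym (List.map-∘ xs))

sumOver-cong : ∀ xs {f g : A → ℤ} → (∀ x → f x ≡ g x) → sumOver xs f ≡ sumOver xs g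
sumOver-cong xs f≗g = cong sumℤ (List.map-cong f≗g xs)

sumOver-zero : ∀ (xs : List A) → sumOver xs (λ _ → 0ℤ) ≡ 0ℤ
sumOver-zero []       = refl
sumOver-zero (x ∷ xs) = trans (ℤ.+-identityˡ _) (sumOver-zero xs)

sumOver-+ : ∀ xs (f g : A → ℤ) → sumOver xs (λ x → f x + g x) ≡ sumOver xs f + sumOver xs g
sumOver-+ []       f g = refl
sumOver-+ (x ∷ xs) f g =
  trans (cong (_+_ (f x + g x)) (sumOver-+ xs f g)) (interchange (f x) (g x) (sumOver xs f) (sumOver xs g))
  where
  interchange : ∀ a b c d → a + b + (c + d) ≡ a + c + (b + d)
  interchange = solve-∀

sumOver-*ˡ : ∀ xs c (f : A → ℤ) → sumOver xs (λ x → c * f x) ≡ c * sumOver xs f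
sumOver-*ˡ []       c f = sym (ℤ.*-zeroʳ c)
sumOver-*ˡ (x ∷ xs) c f =
  trans (cong (_+_ (c * f x)) (sumOver-*ˡ xs c f)) (sym (ℤ.*-distribˡ-+ c (f x) _))

sumOver-*ʳ : ∀ xs c (f : A → ℤ) → sumOver xs (λ x → f x * c) ≡ sumOver xs f * c
sumOver-*ʳ xs c f = trans (sumOver-cong xs (λ x → ℤ.*-comm (f x) c))
                          (trans (sumOver-*ˡ xs c f) (ℤ.*-comm c _))

sumOver-neg : ∀ xs (f : A → ℤ) → sumOver xs (λ x → - f x) ≡ - sumOver xs f
sumOver-neg xs f = trans (sumOver-cong xs (λ x → sym (ℤ.-1*i≡-i (f x))))
                         (trans (sumOver-*ˡ xs -1ℤ f) (ℤ.-1*i≡-i _))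

sumOver-minus : ∀ xs (f g : A → ℤ) → sumOver xs (λ x → f x - g x) ≡ sumOver xs f - sumOver xs g
sumOver-minus xs f g =
  trans (sumOver-+ xs f (λ x → - g x)) (cong (_+_ (sumOver xs f)) (sumOver-neg xs g))

sumOver-comm : ∀ (xs : List A) (ys : List B) (f : A → B → ℤ) →
               sumOver xs (λ x → sumOver ys (f x)) ≡ sumOver ys (λ y → sumOver xs (λ x → f x y))
sumOver-comm []       ys f = sym (sumOver-zero ys)
sumOver-comm (x ∷ xs) ys f =
  trans (cong (_+_ (sumOver ys (f x))) (sumOver-comm xs ys f)) (sym (sumOver-+ ys (f x) _))

sumOver-filterᵇ : ∀ xs (p : A → Bool) (f : A → ℤ) →
                  sumOver (filterᵇ p xs) f ≡ sumOver xs (λ x → [ p x ]× f x)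
sumOver-filterᵇ []       p f = refl
sumOver-filterᵇ (x ∷ xs) p f with p x
... | true  = cong (_+_ (f x)) (sumOver-filterᵇ xs p f)
... | false = trans (sumOver-filterᵇ xs p f) (sym (ℤ.+-identityˡ _))

length-filterᵇ-* : ∀ xs (p : A → Bool) c → + length (filterᵇ p xs) * c ≡ sumOver xs (λ x → [ p x ]× c)
length-filterᵇ-* []       p c = refl
length-filterᵇ-* (x ∷ xs) p c with p x
... | true  = trans (ℤ.*-distribʳ-+ c 1ℤ (+ length (filterᵇ p xs)))
                    (cong₂ _+_ (ℤ.*-identityˡ c) (length-filterᵇ-* xs p c))
... | false = trans (length-filterᵇ-* xs p c) (sym (ℤ.+-identityˡ _))

map-applyUpTo : ∀ (f : A → B) g N → map f (applyUpTo g N) ≡ applyUpTo (f ∘ g) N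
map-applyUpTo f g zero    = refl
map-applyUpTo f g (suc N) = cong (f (g 0) ∷_) (map-applyUpTo f (g ∘ suc) N)

sum-applyUpTo-indicator : ∀ N m (c : ℕ → ℤ) → m < N →
                          sumℤ (applyUpTo (λ k → [ m ≡ᵇ k ]× c k) N) ≡ c m
sum-applyUpTo-indicator (suc N) zero c _ =
  trans (cong (_+_ (c 0)) (trans (cong sumℤ (sym (map-applyUpTo (λ _ → 0ℤ) id N))) (sumOver-zero (upTo N))))
        (ℤ.+-identityʳ (c 0))
sum-applyUpTo-indicator (suc N) (suc m) c (s≤s m<N) =
  trans (ℤ.+-identityˡ _) (sum-applyUpTo-indicator N m (c ∘ suc) m<N)

sumOver-upTo-indicator : ∀ N m (c : ℕ → ℤ) → m < N → sumOver (upTo N) (λ k → [ m ≡ᵇ k ]× c k) ≡ c m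
sumOver-upTo-indicator N m c m<N =
  trans (cong sumℤ (map-applyUpTo _ id N)) (sum-applyUpTo-indicator N m c m<N)

∧-true⁻ : ∀ {a b} → a ∧ b ≡ true → a ≡ true × b ≡ true
∧-true⁻ {true} b≡true = refl , b≡true

∨-true⁻ : ∀ {a b} → a ∨ b ≡ true → a ≡ true ⊎ b ≡ true
∨-true⁻ {true}  _      = inj₁ refl
∨-true⁻ {false} b≡true = inj₂ b≡true

∨-true⁺ʳ : ∀ a {b} → b ≡ true → a ∨ b ≡ true
∨-true⁺ʳ a refl = Bool.∨-zeroʳ a

not-true⁺ : ∀ {a} → ¬ (a ≡ true) → not a ≡ true
not-true⁺ {true}  a≢true = ⊥-elim (a≢true refl)
not-true⁺ {false} _      = refl

not-true⁻ : ∀ {a} → not a ≡ true → ¬ (a ≡ true)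
not-true⁻ {true} () _

bool-ext : ∀ {a b} → (a ≡ true → b ≡ true) → (b ≡ true → a ≡ true) → a ≡ b
bool-ext {true}          a⇒b _   = sym (a⇒b refl)
bool-ext {false} {true}  _   b⇒a = b⇒a refl
bool-ext {false} {false} _   _   = refl

allV-suc : (p : Fin (suc n) → Bool) → allV p ≡ p zero ∧ allV (p ∘ suc)
allV-suc {n} p = cong (p zero ∧_)
  (trans (cong (foldr (λ v b → p v ∧ b) true) (sym (List.map-tabulate id suc)))
         (List.foldr-map _ suc true (allFin n)))

anyV-suc : (p : Fin (suc n) → Bool) → anyV p ≡ p zero ∨ anyV (p ∘ suc)
anyV-suc {n} p = cong (p zero ∨_)
  (trans (cong (foldr (λ v b → p v ∨ b) false) (sym (List.map-tabulate id suc)))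
         (List.foldr-map _ suc false (allFin n)))

allV⁻ : ∀ (p : Fin n → Bool) → allV p ≡ true → ∀ v → p v ≡ true
allV⁻ p all zero    = proj₁ (∧-true⁻ (trans (sym (allV-suc p)) all))
allV⁻ p all (suc v) = allV⁻ (p ∘ suc) (proj₂ (∧-true⁻ (trans (sym (allV-suc p)) all))) v

allV⁺ : ∀ (p : Fin n → Bool) → (∀ v → p v ≡ true) → allV p ≡ true
allV⁺ {zero}  p _   = refl
allV⁺ {suc n} p all = trans (allV-suc p) (cong₂ _∧_ (all zero) (allV⁺ (p ∘ suc) (all ∘ suc)))

anyV⁻ : ∀ (p : Fin n → Bool) → anyV p ≡ true → ∃ λ v → p v ≡ true
anyV⁻ {suc n} p any with ∨-true⁻ (trans (sym (anyV-suc p)) any)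
... | inj₁ p0   = zero , p0
... | inj₂ rest = let v , pv = anyV⁻ (p ∘ suc) rest in suc v , pv

anyV⁺ : ∀ (p : Fin n → Bool) v → p v ≡ true → anyV p ≡ true
anyV⁺ p zero    pv = trans (anyV-suc p) (cong (_∨ anyV (p ∘ suc)) pv)
anyV⁺ p (suc v) pv = trans (anyV-suc p) (∨-true⁺ʳ (p zero) (anyV⁺ (p ∘ suc) v pv))

allV-cong : ∀ {p q : Fin n → Bool} → (∀ v → p v ≡ q v) → allV p ≡ allV q
allV-cong {p = p} {q} p≗q = bool-ext (λ all → allV⁺ q λ v → trans (sym (p≗q v)) (allV⁻ p all v))
                                     (λ all → allV⁺ p λ v → trans (p≗q v) (allV⁻ q all v))

avoids-∷ : ∀ a b (J A : Subset n) → avoids (a ∷ J) (b ∷ A) ≡ not (a ∧ b) ∧ avoids J A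
avoids-∷ a b J A = allV-suc (λ v → not (lookup (a ∷ J) v ∧ lookup (b ∷ A) v))

avoids⁻ : ∀ (J A : Subset n) → avoids J A ≡ true → ∀ {v} → lookup J v ≡ true → ¬ (lookup A v ≡ true)
avoids⁻ J A J∩A≡∅ {v} Jv Av = not-true⁻ (allV⁻ _ J∩A≡∅ v) (cong₂ _∧_ Jv Av)

avoids⁺ : ∀ (J A : Subset n) → (∀ {v} → lookup J v ≡ true → ¬ (lookup A v ≡ true)) → avoids J A ≡ true
avoids⁺ J A disjoint =
  allV⁺ _ λ v → not-true⁺ λ both → let Jv , Av = ∧-true⁻ both in disjoint {v} Jv Av

-- avoids J A is avoidsOn (allFin n) J A by definition.
avoidsOn : List (Fin n) → Subset n → Subset n → Bool
avoidsOn vs J A = foldr (λ v b → not (lookup J v ∧ lookup A v) ∧ b) true vs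

sumSubsets : ∀ n → (Subset n → ℤ) → ℤ
sumSubsets n = sumOver (allSubsets n)

sumSubsets-∷ : ∀ n (f : Subset (suc n) → ℤ) →
               sumSubsets (suc n) f ≡ sumSubsets n (λ J → f (inside ∷ J)) + sumSubsets n (λ J → f (outside ∷ J))
sumSubsets-∷ n f =
  trans (sumOver-++ (map (inside ∷_) (allSubsets n)) _ f)
        (cong₂ _+_ (sumOver-map (allSubsets n) (inside ∷_) f) (sumOver-map (allSubsets n) (outside ∷_) f))

toggle : Fin n → Subset n → Subset n
toggle u J = updateAt J u not

lookup-toggle-≢ : ∀ {u w} (J : Subset n) → w ≢ u → lookup (toggle u J) w ≡ lookup J w
lookup-toggle-≢ {u = u} {w} J w≢u = Vec.lookup∘updateAt′ w u w≢u J

avoidsOn-toggle : ∀ vs {u} (J A : Subset n) → lookup A u ≡ false → avoidsOn vs (toggle u J) A ≡ avoidsOn vs J A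
avoidsOn-toggle []           J A Au = refl
avoidsOn-toggle (w ∷ ws) {u} J A Au = cong₂ (λ a b → not a ∧ b) sameAt (avoidsOn-toggle ws J A Au)
  where
  sameAt : lookup (toggle u J) w ∧ lookup A w ≡ lookup J w ∧ lookup A w
  sameAt with w ≟ u
  ... | yes refl rewrite Au = trans (Bool.∧-zeroʳ _) (sym (Bool.∧-zeroʳ _))
  ... | no  w≢u  = cong (_∧ lookup A w) (lookup-toggle-≢ J w≢u)

sumSubsets-toggle : ∀ n (u : Fin n) (f : Subset n → ℤ) → sumSubsets n (f ∘ toggle u) ≡ sumSubsets n f
sumSubsets-toggle (suc n) zero f =
  trans (sumSubsets-∷ n (f ∘ toggle zero))
        (trans (ℤ.+-comm (sumSubsets n (λ J → f (outside ∷ J))) _) (sym (sumSubsets-∷ n f)))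
sumSubsets-toggle (suc n) (suc u) f =
  trans (sumSubsets-∷ n (f ∘ toggle (suc u)))
        (trans (cong₂ _+_ (sumSubsets-toggle n u _) (sumSubsets-toggle n u _)) (sym (sumSubsets-∷ n f)))

sumSubsets-toggle-odd : ∀ n (u : Fin n) (f : Subset n → ℤ) → (∀ J → f (toggle u J) ≡ - f J) →
                        sumSubsets n f ≡ 0ℤ
sumSubsets-toggle-odd n u f odd = x≡-x⇒x≡0 (begin
  sumSubsets n f              ≡⟨ sumSubsets-toggle n u f ⟨
  sumSubsets n (f ∘ toggle u) ≡⟨ sumOver-cong (allSubsets n) odd ⟩
  sumSubsets n (λ J → - f J)  ≡⟨ sumOver-neg (allSubsets n) f ⟩
  - sumSubsets n f            ∎)
  where open ≡-Reasoning

sign : Subset n → ℤ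
sign J = -1ℤ ^ ∣ J ∣

sign-toggle : ∀ (u : Fin n) J → sign (toggle u J) ≡ - sign J
sign-toggle zero    (true  ∷ J) = sym (trans (cong -_ (ℤ.-1*i≡-i (sign J))) (ℤ.neg-involutive (sign J)))
sign-toggle zero    (false ∷ J) = ℤ.-1*i≡-i (sign J)
sign-toggle (suc u) (true  ∷ J) = trans (cong (-1ℤ *_) (sign-toggle u J))
                                        (trans (ℤ.-1*i≡-i _) (cong -_ (sym (ℤ.-1*i≡-i (sign J)))))
sign-toggle (suc u) (false ∷ J) = sign-toggle u J

sumSubsets-avoiding-power : ∀ n x (D : Subset n) →
                            sumSubsets n (λ S → [ avoids S D ]× x ^ ∣ S ∣) ≡ (x + 1ℤ) ^ (n ∸ ∣ D ∣)
sumSubsets-avoiding-power zero    x []          = ℤ.+-identityʳ 1ℤ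
sumSubsets-avoiding-power (suc n) x (true  ∷ D) = begin
  sumSubsets (suc n) (λ S → [ avoids S (true ∷ D) ]× x ^ ∣ S ∣)
    ≡⟨ sumSubsets-∷ n _ ⟩
  sumSubsets n (λ S → [ avoids (true ∷ S) (true ∷ D) ]× x ^ suc ∣ S ∣)
    + sumSubsets n (λ S → [ avoids (false ∷ S) (true ∷ D) ]× x ^ ∣ S ∣)
    ≡⟨ cong₂ _+_ (sumOver-cong (allSubsets n) λ S → cong ([_]× x ^ suc ∣ S ∣) (avoids-∷ true true S D))
                 (sumOver-cong (allSubsets n) λ S → cong ([_]× x ^ ∣ S ∣) (avoids-∷ false true S D)) ⟩
  sumSubsets n (λ _ → 0ℤ) + rest
    ≡⟨ cong (_+ rest) (sumOver-zero (allSubsets n)) ⟩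
  0ℤ + rest
    ≡⟨ ℤ.+-identityˡ rest ⟩
  rest
    ≡⟨ sumSubsets-avoiding-power n x D ⟩
  (x + 1ℤ) ^ (n ∸ ∣ D ∣) ∎
  where
  open ≡-Reasoning
  rest = sumSubsets n (λ S → [ avoids S D ]× x ^ ∣ S ∣)
sumSubsets-avoiding-power (suc n) x (false ∷ D) = begin
  sumSubsets (suc n) (λ S → [ avoids S (false ∷ D) ]× x ^ ∣ S ∣)
    ≡⟨ sumSubsets-∷ n _ ⟩
  sumSubsets n (λ S → [ avoids (true ∷ S) (false ∷ D) ]× (x * x ^ ∣ S ∣))
    + sumSubsets n (λ S → [ avoids (false ∷ S) (false ∷ D) ]× x ^ ∣ S ∣)
    ≡⟨ cong₂ _+_ (sumOver-cong (allSubsets n) λ S →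
                    trans (cong ([_]× (x * x ^ ∣ S ∣)) (avoids-∷ true false S D)) ([]×-*ˡ (avoids S D) x _))
                 (sumOver-cong (allSubsets n) λ S → cong ([_]× x ^ ∣ S ∣) (avoids-∷ false false S D)) ⟩
  sumSubsets n (λ S → x * [ avoids S D ]× x ^ ∣ S ∣) + rest
    ≡⟨ cong (_+ rest) (sumOver-*ˡ (allSubsets n) x _) ⟩
  x * rest + rest
    ≡⟨ cong (λ r → x * r + r) (sumSubsets-avoiding-power n x D) ⟩
  x * (x + 1ℤ) ^ (n ∸ ∣ D ∣) + (x + 1ℤ) ^ (n ∸ ∣ D ∣)
    ≡⟨ factor x _ ⟩
  (x + 1ℤ) ^ suc (n ∸ ∣ D ∣)
    ≡⟨ cong ((x + 1ℤ) ^_) (ℕ.+-∸-assoc 1 (∣p∣≤n D)) ⟨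
  (x + 1ℤ) ^ (suc n ∸ ∣ D ∣) ∎
  where
  open ≡-Reasoning
  rest = sumSubsets n (λ S → [ avoids S D ]× x ^ ∣ S ∣)
  factor : ∀ x p → x * p + p ≡ (x + 1ℤ) * p
  factor = solve-∀

full-indicator≡0^ : ∀ n (C : Subset n) → [ allV (lookup C) ]× 1ℤ ≡ 0ℤ ^ (n ∸ ∣ C ∣)
full-indicator≡0^ zero    []          = refl
full-indicator≡0^ (suc n) (true  ∷ C) =
  trans (cong ([_]× 1ℤ) (allV-suc (lookup (true ∷ C)))) (full-indicator≡0^ n C)
full-indicator≡0^ (suc n) (false ∷ C) =
  trans (cong ([_]× 1ℤ) (allV-suc (lookup (false ∷ C)))) (cong (0ℤ ^_) (sym (ℕ.+-∸-assoc 1 (∣p∣≤n C))))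

sumSubsets-avoiding-sign : ∀ (A : Subset n) {w} → lookup A w ≡ false →
                           sumSubsets n (λ J → [ avoids J A ]× sign J) ≡ 0ℤ
sumSubsets-avoiding-sign {n} A {w} Aw = begin
  sumSubsets n (λ J → [ avoids J A ]× sign J) ≡⟨ sumSubsets-avoiding-power n -1ℤ A ⟩
  0ℤ ^ (n ∸ ∣ A ∣)                             ≡⟨ full-indicator≡0^ n A ⟨
  [ allV (lookup A) ]× 1ℤ                     ≡⟨ cong ([_]× 1ℤ) notFull ⟩
  0ℤ                                          ∎
  where
  open ≡-Reasoning
  notFull : allV (lookup A) ≡ false
  notFull = Bool.¬-not λ full → case trans (sym (allV⁻ (lookup A) full w)) Aw of λ ()

distinct∈⇒2≤∣p∣ : ∀ {p : Subset n} {v w} → v ∈ p → w ∈ p → v ≢ w → 2 ≤ ∣ p ∣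
distinct∈⇒2≤∣p∣ v∈p w∈p v≢w =
  ℕ.≤-trans (s≤s (ℕ.≤-trans (s≤s z≤n) (x∈p⇒∣p-x∣<∣p∣ (x∈p∧x≢y⇒x∈p-y v∈p v≢w))))
            (x∈p⇒∣p-x∣<∣p∣ w∈p)

all-inside⇒∣p∣≡n : ∀ (p : Subset n) → (∀ v → lookup p v ≡ true) → ∣ p ∣ ≡ n
all-inside⇒∣p∣≡n []      _    = refl
all-inside⇒∣p∣≡n (b ∷ p) full with full zero
... | refl = cong suc (all-inside⇒∣p∣≡n p (full ∘ suc))

foldr-⊓-≤ : ∀ (h : A → ℕ) d {v} xs → Any (v ≡_) xs → foldr (λ w k → h w ⊓ k) d xs ≤ h v
foldr-⊓-≤ h d (w ∷ xs) (here refl)  = ℕ.m⊓n≤m (h w) _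
foldr-⊓-≤ h d (w ∷ xs) (there v∈xs) = ℕ.≤-trans (ℕ.m⊓n≤n (h w) _) (foldr-⊓-≤ h d xs v∈xs)

minDeg≤deg : ∀ {m} (G : Graph (suc m)) v → minDeg G ≤ deg G v
minDeg≤deg G v = foldr-⊓-≤ (deg G) (deg G zero) _ (∈-allFin v)

module ClosedNeighbourhood {n} (G : Graph n) where

  N[_] : Subset n → Subset n
  N[ K ] = closedNbhd G K

  alternating : (Subset n → ℤ) → Subset n → ℤ
  alternating φ J = sign J * φ N[ J ]

  lookup-N : ∀ K v → lookup N[ K ] v ≡ lookup K v ∨ anyV (λ u → lookup K u ∧ adj G u v)
  lookup-N K v = Vec.lookup∘tabulate _ v

  ∈N-self : ∀ K {v} → lookup K v ≡ true → lookup N[ K ] v ≡ true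
  ∈N-self K {v} Kv = trans (lookup-N K v) (cong (_∨ anyV (λ u → lookup K u ∧ adj G u v)) Kv)

  ∈N-adj : ∀ K {u v} → lookup K u ≡ true → adj G u v ≡ true → lookup N[ K ] v ≡ true
  ∈N-adj K {u} {v} Ku uv = trans (lookup-N K v)
    (∨-true⁺ʳ (lookup K v) (anyV⁺ (λ w → lookup K w ∧ adj G w v) u (cong₂ _∧_ Ku uv)))

  Dominates : Subset n → Fin n → Set
  Dominates K v = lookup K v ≡ true ⊎ ∃ λ u → lookup K u ≡ true × adj G u v ≡ true

  ∈N⁻ : ∀ K {v} → lookup N[ K ] v ≡ true → Dominates K v
  ∈N⁻ K {v} v∈N[K] with ∨-true⁻ (trans (sym (lookup-N K v)) v∈N[K])
  ... | inj₁ Kv  = inj₁ Kv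
  ... | inj₂ any = let u , Ku∧uv = anyV⁻ (λ w → lookup K w ∧ adj G w v) any
                   in inj₂ (u , ∧-true⁻ Ku∧uv)

  avoids-N-comm : ∀ J S → avoids J N[ S ] ≡ avoids S N[ J ]
  avoids-N-comm J S = bool-ext (avoids-N⇒ J S) (avoids-N⇒ S J)
    where
    avoids-N⇒ : ∀ J S → avoids J N[ S ] ≡ true → avoids S N[ J ] ≡ true
    avoids-N⇒ J S J∩N[S]≡∅ = avoids⁺ S N[ J ] λ Sw w∈N[J] → absurd Sw (∈N⁻ J w∈N[J])
      where
      absurd : ∀ {w} → lookup S w ≡ true → Dominates J w → ⊥
      absurd     Sw (inj₁ Jw)            = avoids⁻ J N[ S ] J∩N[S]≡∅ Jw (∈N-self S Sw)
      absurd {w} Sw (inj₂ (u , Ju , uw)) =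
        avoids⁻ J N[ S ] J∩N[S]≡∅ Ju (∈N-adj S Sw (trans (Graph.sym G w u) uw))

  isDominating≡full : ∀ S → isDominating G S ≡ allV (lookup N[ S ])
  isDominating≡full S = allV-cong λ v → sym (lookup-N S v)

  domPoly≡sumDominating : ∀ x → domPoly G x ≡ sumSubsets n (λ S → [ isDominating G S ]× x ^ ∣ S ∣)
  domPoly≡sumDominating x = begin
    domPoly G x
      ≡⟨ sumOver-cong (upTo (suc n)) (λ k → length-filterᵇ-* (allSubsets n) (dominatingOfSize k) (x ^ k)) ⟩
    sumOver (upTo (suc n)) (λ k → sumSubsets n (λ S → [ dominatingOfSize k S ]× x ^ k))
      ≡⟨ sumOver-comm (upTo (suc n)) (allSubsets n) (λ k S → [ dominatingOfSize k S ]× x ^ k) ⟩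
    sumSubsets n (λ S → sumOver (upTo (suc n)) (λ k → [ dominatingOfSize k S ]× x ^ k))
      ≡⟨ sumOver-cong (allSubsets n) sizeTerm ⟩
    sumSubsets n (λ S → [ isDominating G S ]× x ^ ∣ S ∣) ∎
    where
    open ≡-Reasoning
    dominatingOfSize : ℕ → Subset n → Bool
    dominatingOfSize k S = isDominating G S ∧ (∣ S ∣ ≡ᵇ k)
    sizeTerm : ∀ S → sumOver (upTo (suc n)) (λ k → [ dominatingOfSize k S ]× x ^ k) ≡
                     [ isDominating G S ]× x ^ ∣ S ∣
    sizeTerm S with isDominating G S
    ... | true  = sumOver-upTo-indicator (suc n) ∣ S ∣ (x ^_) (s≤s (∣p∣≤n S))
    ... | false = sumOver-zero (upTo (suc n))

  dominating-indicator : ∀ S y →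
    [ isDominating G S ]× y ≡ sumSubsets n (λ J → [ avoids J N[ S ] ]× (sign J * y))
  dominating-indicator S y = begin
    [ isDominating G S ]× y
      ≡⟨ []×-1 (isDominating G S) y ⟩
    [ isDominating G S ]× 1ℤ * y
      ≡⟨ cong (λ b → [ b ]× 1ℤ * y) (isDominating≡full S) ⟩
    [ allV (lookup N[ S ]) ]× 1ℤ * y
      ≡⟨ cong (_* y) (full-indicator≡0^ n N[ S ]) ⟩
    0ℤ ^ (n ∸ ∣ N[ S ] ∣) * y
      ≡⟨ cong (_* y) (sumSubsets-avoiding-power n -1ℤ N[ S ]) ⟨
    sumSubsets n (λ J → [ avoids J N[ S ] ]× sign J) * y
      ≡⟨ sumOver-*ʳ (allSubsets n) y _ ⟨
    sumSubsets n (λ J → [ avoids J N[ S ] ]× sign J * y)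
      ≡⟨ sumOver-cong (allSubsets n) (λ J → []×-*ʳ (avoids J N[ S ]) (sign J) y) ⟨
    sumSubsets n (λ J → [ avoids J N[ S ] ]× (sign J * y)) ∎
    where open ≡-Reasoning

  domPoly≡alternatingSum : ∀ x → domPoly G x ≡ sumSubsets n (alternating (λ C → (x + 1ℤ) ^ (n ∸ ∣ C ∣)))
  domPoly≡alternatingSum x = begin
    domPoly G x
      ≡⟨ domPoly≡sumDominating x ⟩
    sumSubsets n (λ S → [ isDominating G S ]× x ^ ∣ S ∣)
      ≡⟨ sumOver-cong (allSubsets n) (λ S → dominating-indicator S (x ^ ∣ S ∣)) ⟩
    sumSubsets n (λ S → sumSubsets n (λ J → [ avoids J N[ S ] ]× (sign J * x ^ ∣ S ∣)))
      ≡⟨ sumOver-comm (allSubsets n) (allSubsets n) _ ⟩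
    sumSubsets n (λ J → sumSubsets n (λ S → [ avoids J N[ S ] ]× (sign J * x ^ ∣ S ∣)))
      ≡⟨ sumOver-cong (allSubsets n) innerSum ⟩
    sumSubsets n (λ J → sign J * (x + 1ℤ) ^ (n ∸ ∣ N[ J ] ∣)) ∎
    where
    open ≡-Reasoning
    innerSum : ∀ J → sumSubsets n (λ S → [ avoids J N[ S ] ]× (sign J * x ^ ∣ S ∣)) ≡
                     sign J * (x + 1ℤ) ^ (n ∸ ∣ N[ J ] ∣)
    innerSum J = begin
      sumSubsets n (λ S → [ avoids J N[ S ] ]× (sign J * x ^ ∣ S ∣))
        ≡⟨ sumOver-cong (allSubsets n) (λ S → trans (cong ([_]× (sign J * x ^ ∣ S ∣)) (avoids-N-comm J S))
                                                    ([]×-*ˡ (avoids S N[ J ]) (sign J) _)) ⟩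
      sumSubsets n (λ S → sign J * [ avoids S N[ J ] ]× x ^ ∣ S ∣)
        ≡⟨ sumOver-*ˡ (allSubsets n) (sign J) _ ⟩
      sign J * sumSubsets n (λ S → [ avoids S N[ J ] ]× x ^ ∣ S ∣)
        ≡⟨ cong (sign J *_) (sumSubsets-avoiding-power n x N[ J ]) ⟩
      sign J * (x + 1ℤ) ^ (n ∸ ∣ N[ J ] ∣) ∎

  adj⇒≢ : ∀ {u v} → adj G u v ≡ true → u ≢ v
  adj⇒≢ {u} uv refl = case trans (sym uv) (irrefl G u) of λ ()

  adj⇒∈neighbours : ∀ {u w} → adj G u w ≡ true → w ∈ tabulate (adj G u)
  adj⇒∈neighbours {u} {w} uw = Vec.lookup⇒[]= w _ (trans (Vec.lookup∘tabulate (adj G u) w) uw)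

  pendant-neighbour-unique : ∀ {u v w} → deg G u ≡ 1 → adj G u v ≡ true → adj G u w ≡ true → w ≡ v
  pendant-neighbour-unique {u} {v} {w} du uv uw with w ≟ v
  ... | yes w≡v = w≡v
  ... | no  w≢v = ⊥-elim (ℕ.<-irrefl refl
                    (subst (2 ≤_) du (distinct∈⇒2≤∣p∣ (adj⇒∈neighbours uw) (adj⇒∈neighbours uv) w≢v)))

  N-⊆-off-pendant : ∀ {u v} → deg G u ≡ 1 → adj G v u ≡ true → ∀ K K' →
                    (∀ {w} → w ≢ u → lookup K w ≡ true → lookup K' w ≡ true) → lookup K' v ≡ true →
                    ∀ {w} → lookup N[ K ] w ≡ true → lookup N[ K' ] w ≡ true
  N-⊆-off-pendant {u} {v} du vu K K' K⊆K' K'v w∈N[K] = from (∈N⁻ K w∈N[K])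
    where
    from : ∀ {w} → Dominates K w → lookup N[ K' ] w ≡ true
    from {w} (inj₁ Kw) with w ≟ u
    ... | yes refl = ∈N-adj K' K'v vu
    ... | no  w≢u  = ∈N-self K' (K⊆K' w≢u Kw)
    from {w} (inj₂ (t , Kt , tw)) with t ≟ u
    ... | yes refl = subst (λ z → lookup N[ K' ] z ≡ true)
                           (sym (pendant-neighbour-unique du (trans (Graph.sym G u v) vu) tw)) (∈N-self K' K'v)
    ... | no  t≢u  = ∈N-adj K' (K⊆K' t≢u Kt) tw

  N-toggle-pendant : ∀ {u v} J → deg G u ≡ 1 → adj G v u ≡ true → lookup J v ≡ true →
                     N[ toggle u J ] ≡ N[ J ]
  N-toggle-pendant {u} {v} J du vu Jv = Pointwise-≡⇒≡ (ext λ w → bool-ext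
    (N-⊆-off-pendant du vu (toggle u J) J (λ w≢u → trans (sym (lookup-toggle-≢ J w≢u))) Jv)
    (N-⊆-off-pendant du vu J (toggle u J) (λ w≢u → trans (lookup-toggle-≢ J w≢u))
                     (trans (lookup-toggle-≢ J (adj⇒≢ vu)) Jv)))

  alternating-toggle-pendant : ∀ φ {u v} J → deg G u ≡ 1 → adj G v u ≡ true → lookup J v ≡ true →
                               alternating φ (toggle u J) ≡ - alternating φ J
  alternating-toggle-pendant φ {u} J du vu Jv =
    trans (cong₂ _*_ (sign-toggle u J) (cong φ (N-toggle-pendant J du vu Jv)))
          (sym (ℤ.neg-distribˡ-* (sign J) (φ N[ J ])))

  terms-containing-cancel : ∀ φ vs (A : Subset n) {u v} →
    deg G u ≡ 1 → adj G v u ≡ true → lookup A u ≡ false → ∀ J → [ lookup (toggle u J) v ∧ avoidsOn vs (toggle u J) A ]× alternating φ (toggle u J)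
            ≡ - ([ lookup J v ∧ avoidsOn vs J A ]× alternating φ J)
  terms-containing-cancel φ vs A {u} {v} du vu Au J
    rewrite lookup-toggle-≢ J (adj⇒≢ vu) | avoidsOn-toggle vs J A Au
    with lookup J v in Jv | avoidsOn vs J A
  ... | false | _     = refl
  ... | true  | false = refl
  ... | true  | true  = alternating-toggle-pendant φ J du vu Jv

  alternatingSum-avoiding : ∀ (A : Subset n) →
    (∀ a → lookup A a ≡ true → ∃ λ u → adj G a u ≡ true × deg G u ≡ 1 × lookup A u ≡ false) →
    ∀ φ → sumSubsets n (λ J → [ avoids J A ]× alternating φ J) ≡ sumSubsets n (alternating φ)
  alternatingSum-avoiding A pendant φ = avoidingOn (allFin n)
    where
    Σ[_] : (Subset n → Bool) → ℤ
    Σ[ p ] = sumSubsets n (λ J → [ p J ]× alternating φ J)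
    avoidingOn : ∀ vs → Σ[ (λ J → avoidsOn vs J A) ] ≡ sumSubsets n (alternating φ)
    avoidingOn []       = refl
    avoidingOn (v ∷ vs) with lookup A v in Av
    ... | false = trans (sumOver-cong (allSubsets n) λ J →
                           cong (λ b → [ not b ∧ avoidsOn vs J A ]× alternating φ J) (Bool.∧-zeroʳ (lookup J v)))
                        (avoidingOn vs)
    ... | true  = let u , vu , du , Au = pendant v Av in begin
      Σ[ (λ J → not (lookup J v ∧ true) ∧ avoidsOn vs J A) ]
        ≡⟨ sumOver-cong (allSubsets n) (λ J → []×-not∧-split (lookup J v) (avoidsOn vs J A) (alternating φ J)) ⟩
      sumSubsets n (λ J → [ avoidsOn vs J A ]× alternating φ J - [ lookup J v ∧ avoidsOn vs J A ]× alternating φ J)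
        ≡⟨ sumOver-minus (allSubsets n) _ _ ⟩
      Σ[ (λ J → avoidsOn vs J A) ] - Σ[ (λ J → lookup J v ∧ avoidsOn vs J A) ]
        ≡⟨ cong (_-_ Σ[ (λ J → avoidsOn vs J A) ])
                (sumSubsets-toggle-odd n u _ (terms-containing-cancel φ vs A du vu Au)) ⟩
      Σ[ (λ J → avoidsOn vs J A) ] - 0ℤ
        ≡⟨ ℤ.+-identityʳ _ ⟩
      Σ[ (λ J → avoidsOn vs J A) ]
        ≡⟨ avoidingOn vs ⟩
      sumSubsets n (alternating φ) ∎
      where open ≡-Reasoning

  ∣J∣≤n∸deg : ∀ J {v} → lookup N[ J ] v ≡ false → ∣ J ∣ ≤ n ∸ deg G v
  ∣J∣≤n∸deg J {v} v∉N[J] =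
    subst (∣ J ∣ ≤_) (∣∁p∣≡n∸∣p∣ (tabulate (adj G v))) (p⊆q⇒∣p∣≤∣q∣ J⊆∁neighbours)
    where
    J⊆∁neighbours : ∀ {w} → w ∈ J → w ∈ ∁ (tabulate (adj G v))
    J⊆∁neighbours {w} w∈J = x∉p⇒x∈∁p λ w∈neighbours →
      let vw = trans (sym (Vec.lookup∘tabulate (adj G v) w)) (Vec.[]=⇒lookup w∈neighbours)
          v∈N[J] = ∈N-adj J (Vec.[]=⇒lookup w∈J) (trans (Graph.sym G w v) vw)
      in case trans (sym v∈N[J]) v∉N[J] of λ ()

  ∣N∣≡n-if-large : ∀ J → (∀ v → n ∸ deg G v < ∣ J ∣) → ∣ N[ J ] ∣ ≡ n
  ∣N∣≡n-if-large J large = all-inside⇒∣p∣≡n N[ J ] full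
    where
    full : ∀ v → lookup N[ J ] v ≡ true
    full v with lookup N[ J ] v in v∈N[J]
    ... | true  = refl
    ... | false = ⊥-elim (ℕ.<⇒≱ (large v) (∣J∣≤n∸deg J v∈N[J]))

∣N∣≡n-if-above-n∸δ : ∀ {m} (G : Graph (suc m)) J → (∣ J ∣ ≤ᵇ (suc m ∸ minDeg G)) ≡ false →
                     ∣ closedNbhd G J ∣ ≡ suc m
∣N∣≡n-if-above-n∸δ {m} G J notSmall = ClosedNeighbourhood.∣N∣≡n-if-large G J λ v →
  ℕ.≤-<-trans (ℕ.∸-monoʳ-≤ (suc m) (minDeg≤deg G v))
              (ℕ.≰⇒> λ small → subst T notSmall (ℕ.≤⇒≤ᵇ small))

domPoly≡firstSum : ∀ (G : Graph n) A →
  (∀ a → lookup A a ≡ true → ∃ λ u → adj G a u ≡ true × deg G u ≡ 1 × lookup A u ≡ false) →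
  ∀ x → domPoly G x ≡ firstSum G A x
domPoly≡firstSum {n} G A pendant x = begin
  domPoly G x
    ≡⟨ domPoly≡alternatingSum x ⟩
  sumSubsets n (alternating φ)
    ≡⟨ alternatingSum-avoiding A pendant φ ⟨
  sumSubsets n (λ J → [ avoids J A ]× alternating φ J)
    ≡⟨ sumOver-filterᵇ (allSubsets n) (λ J → avoids J A) (alternating φ) ⟨
  firstSum G A x ∎
  where
  open ≡-Reasoning
  open ClosedNeighbourhood G
  φ : Subset n → ℤ
  φ C = (x + 1ℤ) ^ (n ∸ ∣ C ∣)

firstSum≡secondSum : ∀ {m} (G : Graph (suc m)) A {w} → lookup A w ≡ false →
                     ∀ x → firstSum G A x ≡ secondSum G A x
firstSum≡secondSum {m} G A Aw x = begin
  firstSum G A x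
    ≡⟨ sumOver-filterᵇ (allSubsets (suc m)) (λ J → avoids J A) (alternating φ) ⟩
  sumSubsets (suc m) (λ J → [ avoids J A ]× alternating φ J)
    ≡⟨ sumOver-cong (allSubsets (suc m)) split ⟩
  sumSubsets (suc m) (λ J → kept J + [ avoids J A ]× sign J)
    ≡⟨ sumOver-+ (allSubsets (suc m)) kept (λ J → [ avoids J A ]× sign J) ⟩
  sumSubsets (suc m) kept + sumSubsets (suc m) (λ J → [ avoids J A ]× sign J)
    ≡⟨ cong (_+_ (sumSubsets (suc m) kept)) (sumSubsets-avoiding-sign A Aw) ⟩
  sumSubsets (suc m) kept + 0ℤ
    ≡⟨ ℤ.+-identityʳ _ ⟩
  sumSubsets (suc m) kept
    ≡⟨ sumOver-filterᵇ (allSubsets (suc m)) (λ J → avoids J A ∧ small J) (alternating (λ C → φ C - 1ℤ)) ⟨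
  secondSum G A x ∎
  where
  open ≡-Reasoning
  open ClosedNeighbourhood G
  φ : Subset (suc m) → ℤ
  φ C = (x + 1ℤ) ^ (suc m ∸ ∣ C ∣)
  small : Subset (suc m) → Bool
  small J = ∣ J ∣ ≤ᵇ (suc m ∸ minDeg G)
  kept : Subset (suc m) → ℤ
  kept J = [ avoids J A ∧ small J ]× alternating (λ C → φ C - 1ℤ) J
  split : ∀ J → [ avoids J A ]× alternating φ J ≡ kept J + [ avoids J A ]× sign J
  split J with avoids J A | small J in smallJ
  ... | false | _     = refl
  ... | true  | true  = peel (sign J) (φ N[ J ])
    where
    peel : ∀ s t → s * t ≡ s * (t - 1ℤ) + s
    peel = solve-∀
  ... | true  | false = begin
    sign J * (x + 1ℤ) ^ (suc m ∸ ∣ N[ J ] ∣)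
      ≡⟨ cong (λ k → sign J * (x + 1ℤ) ^ (suc m ∸ k)) (∣N∣≡n-if-above-n∸δ G J smallJ) ⟩
    sign J * (x + 1ℤ) ^ (suc m ∸ suc m)
      ≡⟨ cong (λ k → sign J * (x + 1ℤ) ^ k) (ℕ.n∸n≡0 (suc m)) ⟩
    sign J * 1ℤ
      ≡⟨ ℤ.*-identityʳ (sign J) ⟩
    sign J
      ≡⟨ ℤ.+-identityˡ (sign J) ⟨
    0ℤ + sign J ∎

corollary5 : ∀ (m : ℕ) (G : Graph (suc m))
    → (∀ v → deg G v ≥ 1)
    → (∀ u v → adj G u v ≡ true → ¬ (deg G u ≡ 1 × deg G v ≡ 1))
    → (A : Subset (suc m))
    → (∀ a → a ∈ A → ∃ λ u → adj G a u ≡ true × deg G u ≡ 1)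
    → ∀ (x : ℤ) → (domPoly G x ≡ firstSum G A x) × (firstSum G A x ≡ secondSum G A x)
corollary5 m G _ noIsolatedEdge A hasLeaf x =
  domPoly≡firstSum G A leafOutsideA x , firstSum≡secondSum G A (proj₂ vertexOutsideA) x
  where
  leaf∉A : ∀ {u} → deg G u ≡ 1 → lookup A u ≡ false
  leaf∉A {u} du with lookup A u in Au
  ... | false = refl
  ... | true  = let w , uw , dw = hasLeaf u (Vec.lookup⇒[]= u A Au) in ⊥-elim (noIsolatedEdge u w uw (du , dw))
  leafOutsideA : ∀ a → lookup A a ≡ true → ∃ λ u → adj G a u ≡ true × deg G u ≡ 1 × lookup A u ≡ false
  leafOutsideA a Aa = let u , au , du = hasLeaf a (Vec.lookup⇒[]= a A Aa) in u , au , du , leaf∉A du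
  vertexOutsideA : ∃ λ w → lookup A w ≡ false
  vertexOutsideA with lookup A zero in A0
  ... | false = zero , A0
  ... | true  = let u , _ , _ , Au = leafOutsideA zero A0 in u , Au
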